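{- Let $(A,B)$ be an invertible Jones pair of $n\times n$ matrices with $A$ symmetric. Then the space $\mathcal B=\{\mathcal M(F,G,H) : F\in\mathcal N_A,\ G,H\in\mathcal N_{A,B}\}$ is closed under the Schur product.
   Context: All matrices are complex. $X\circ Y$ is the Schur product; $X^{(-)}$ is the Schur inverse of a matrix with no zero entries. $W$ ($n\times n$) is type-II if $W(W^{(-)})^T=nI$. For a matrix $C$, $X_C(M)=CM$, $\Delta_C(M)=C\circ M$. A Jones pair is a pair $(A,B)$ of $n\times n$ matrices with $X_A$, $\Delta_B$ invertible, $X_A\Delta_BX_A=\Delta_BX_A\Delta_B$ and $X_A\Delta_{B^T}X_A=\Delta_{B^T}X_A\Delta_{B^T}$; it is invertible if moreover $A$ has no zero entry and $B$ is invertible (equivalently $A,B$ type-II). With $e_1,\dots,e_n$ the standard basis, for $P$ invertible and $Q$ without zero entries, $\mathcal N_{P,Q}$ is the set of matrices $M$ such that every $Pe_i\circ Qe_j$ is an eigenvector of $M$, and $\Theta_{P,Q}(M)$ is the matrix with $M(Pe_i\circ Qe_j)=\Theta_{P,Q}(M)_{ij}(Pe_i\circ Qe_j)$. For type-II $P$, $\mathcal N_P:=\mathcal N_{P,P^{(-)}}$, $\Theta_P:=\Theta_{P,P^{(-)}}$. Standing facts for the definitions: $\mathcal N_{A,B}=\mathcal N_{A,B^T}$ is closed under transposition and $\mathcal N_A=\mathcal N_{B^{(-)}}$. Pairing: for $H\in\mathcal N_{A,B}$, the matrix paired with $H$ is the unique $K$ with $K^T\in\mathcal N_{A,B^T}$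 and $\Theta_{A,B}(H)=\Theta_{A,B^T}(K^T)^T$. For $F\in\mathcal N_A$, $G,H\in\mathcal N_{A,B}$, with $K$ paired with $H$, \[ \mathcal M(F,G,H)=\begin{pmatrix} \Theta_A(F)+H & \Theta_A(F)-H & \Theta_{A,B}(G) & \Theta_{A,B}(G)\\ \Theta_A(F)-H & \Theta_A(F)+H & \Theta_{A,B}(G) & \Theta_{A,B}(G)\\ \Theta_{A,B}(G^T)^T & \Theta_{A,B}(G^T)^T & \Theta_{B^{(-)}}(F)+K & \Theta_{B^{(-)}}(F)-K\\ \Theta_{A,B}(G^T)^T & \Theta_{A,B}(G^T)^T & \Theta_{B^{(-)}}(F)-K & \Theta_{B^{(-)}}(F)+K \end{pmatrix}. \] -}

module Defs where

open import Level using (_⊔_) renaming (suc to lsuc)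
open import Algebra.Bundles using (CommutativeRing)
open import Data.Nat using (ℕ; zero; suc)
open import Data.Fin using (Fin; zero; suc)
open import Data.List using (List; _∷_; foldr)
open import Data.Product using (Σ; ∃; _×_; _,_)
open import Relation.Nullary using (¬_)

-- An algebraically closed field of characteristic 0 (stand-in for ℂ).
-- Inverse is a total function, only constrained on nonzero elements.

module RingOps {c ℓ} (R : CommutativeRing c ℓ) where
  open CommutativeRing R using (Carrier; _+_; _*_; 0#; 1#)
  ofℕ : ℕ → Carrier
  ofℕ zero    = 0#
  ofℕ (suc m) = 1# + ofℕ m
  -- value at x of the monic polynomial c₀ + c₁x + … + c_{k-1}x^{k-1} + x^k
  monic : List Carrier → Carrier → Carrier
  monic cs x = foldr (λ a acc → a + x * acc) 1# cs

record ACField c ℓ : Set (lsuc (c ⊔ ℓ)) where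
  field
    cring : CommutativeRing c ℓ
  open CommutativeRing cring public
  open RingOps cring public
  field
    _⁻¹       : Carrier → Carrier
    0≉1       : ¬ (0# ≈ 1#)
    inverseʳ  : ∀ x → ¬ (x ≈ 0#) → x * (x ⁻¹) ≈ 1#
    charZero  : ∀ m → ¬ (ofℕ (suc m) ≈ 0#)
    algClosed : ∀ (c₀ : Carrier) (cs : List Carrier) → ∃ λ x → monic (c₀ ∷ cs) x ≈ 0#

module _ {c ℓ} (K : ACField c ℓ) where
  open ACField K using (Carrier; _≈_; _+_; _*_; -_; 0#; 1#; _⁻¹)

  MatOn : Set → Set c
  MatOn I = I → I → Carrier

  Mat : ℕ → Set c
  Mat n = MatOn (Fin n)

  Vect : ℕ → Set c
  Vect n = Fin n → Carrier

  _≋_ : ∀ {I : Set} → MatOn I → MatOn I → Set ℓ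
  M ≋ N = ∀ i j → M i j ≈ N i j

  _≋ᵥ_ : ∀ {n} → Vect n → Vect n → Set ℓ
  u ≋ᵥ v = ∀ i → u i ≈ v i

  Σ[<] : ∀ {n} → (Fin n → Carrier) → Carrier
  Σ[<] {zero}  f = 0#
  Σ[<] {suc n} f = f zero + Σ[<] (λ i → f (suc i))

  _∘ₛ_ : ∀ {I : Set} → MatOn I → MatOn I → MatOn I
  (M ∘ₛ N) i j = M i j * N i j

  _∘ᵥ_ : ∀ {n} → Vect n → Vect n → Vect n
  (u ∘ᵥ v) i = u i * v i

  _·ᵥ_ : ∀ {n} → Carrier → Vect n → Vect n
  (a ·ᵥ v) i = a * v i

  _⊕_ : ∀ {n} → Mat n → Mat n → Mat n
  (M ⊕ N) i j = M i j + N i j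

  _⊖_ : ∀ {n} → Mat n → Mat n → Mat n
  (M ⊖ N) i j = M i j + - N i j

  _⊗_ : ∀ {n} → Mat n → Mat n → Mat n
  (M ⊗ N) i j = Σ[<] (λ k → M i k * N k j)

  _*ᵥ_ : ∀ {n} → Mat n → Vect n → Vect n
  (M *ᵥ v) i = Σ[<] (λ k → M i k * v k)

  _ᵀ : ∀ {n} → Mat n → Mat n
  (M ᵀ) i j = M j i

  col : ∀ {n} → Mat n → Fin n → Vect n
  col P i k = P k i

  -- Schur inverse (meaningful when there are no zero entries)
  schurInv : ∀ {n} → Mat n → Mat n
  schurInv M i j = (M i j) ⁻¹

  NoZeroEntry : ∀ {n} → Mat n → Set ℓ
  NoZeroEntry M = ∀ i j → ¬ (M i j ≈ 0#)

  Symmetric : ∀ {n} → Mat n → Set ℓ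
  Symmetric M = M ≋ (M ᵀ)

  InvertibleOp : ∀ {n} → (Mat n → Mat n) → Set (c ⊔ ℓ)
  InvertibleOp {n} f =
    Σ (Mat n → Mat n) λ g → (∀ M → f (g M) ≋ M) × (∀ M → g (f M) ≋ M)

  X[_] : ∀ {n} → Mat n → Mat n → Mat n
  X[ C ] M = C ⊗ M

  Δ[_] : ∀ {n} → Mat n → Mat n → Mat n
  Δ[ C ] M = C ∘ₛ M

  JonesPair : ∀ {n} → Mat n → Mat n → Set (c ⊔ ℓ)
  JonesPair A B =
    InvertibleOp X[ A ] × InvertibleOp Δ[ B ] ×
    (∀ M → X[ A ] (Δ[ B ] (X[ A ] M)) ≋ Δ[ B ] (X[ A ] (Δ[ B ] M))) ×
    (∀ M → X[ A ] (Δ[ B ᵀ ] (X[ A ] M)) ≋ Δ[ B ᵀ ] (X[ A ] (Δ[ B ᵀ ] M)))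

  InvertibleMat : ∀ {n} → Mat n → Set (c ⊔ ℓ)
  InvertibleMat {n} B = Σ (Mat n) λ C → (B ⊗ C) ≋ (λ i j → δ i j) × (C ⊗ B) ≋ (λ i j → δ i j)
    where
    δ : Fin n → Fin n → Carrier
    δ zero    zero    = 1#
    δ zero    (suc j) = 0#
    δ (suc i) zero    = 0#
    δ (suc i) (suc j) = δ′ i j
      where
      δ′ : ∀ {m} → Fin m → Fin m → Carrier
      δ′ zero    zero    = 1#
      δ′ zero    (suc j) = 0#
      δ′ (suc i) zero    = 0#
      δ′ (suc i) (suc j) = δ′ i j

  InvertibleJonesPair : ∀ {n} → Mat n → Mat n → Set (c ⊔ ℓ)
  InvertibleJonesPair A B = JonesPair A B × NoZeroEntry A × InvertibleMat B

  -- θ is Θ_{P,Q}(M): M (Pe_i ∘ Qe_j) = θ_ij (Pe_i ∘ Qe_j) for all i j.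
  -- M ∈ 𝓝_{P,Q} iff such a θ exists.
  IsΘ : ∀ {n} → Mat n → Mat n → Mat n → Mat n → Set ℓ
  IsΘ P Q M θ = ∀ i j → (M *ᵥ (col P i ∘ᵥ col Q j)) ≋ᵥ (θ i j ·ᵥ (col P i ∘ᵥ col Q j))

  IsΘ₁ : ∀ {n} → Mat n → Mat n → Mat n → Set ℓ
  IsΘ₁ P M θ = IsΘ P (schurInv P) M θ

  -- 𝓜(F,G,H) given the relevant Θ-values and the matrix K paired with H
  -- Rows/columns indexed by Fin 4 × Fin n (block index, index in block).
  𝓜 : ∀ {n} → (θFA θFB θG θGT H K : Mat n) → MatOn (Fin 4 × Fin n)
  𝓜 θFA θFB θG θGT H K (a , i) (b , j) = blk a b i j
    where
    P = θFA ⊕ H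
    Mi = θFA ⊖ H
    R = θFB ⊕ K
    S = θFB ⊖ K
    blk : Fin 4 → Fin 4 → Mat _
    blk zero          zero          = P
    blk zero          (suc zero)    = Mi
    blk (suc zero)    zero          = Mi
    blk (suc zero)    (suc zero)    = P
    blk zero          (suc (suc _)) = θG
    blk (suc zero)    (suc (suc _)) = θG
    blk (suc (suc _)) zero          = θGT ᵀ
    blk (suc (suc _)) (suc zero)    = θGT ᵀ
    blk (suc (suc zero)) (suc (suc zero)) = R
    blk (suc (suc zero)) (suc (suc (suc _))) = S
    blk (suc (suc (suc _))) (suc (suc zero)) = S
    blk (suc (suc (suc _))) (suc (suc (suc _))) = R

  In𝓑 : ∀ {n} → Mat n → Mat n → MatOn (Fin 4 × Fin n) → Set (c ⊔ ℓ)
  In𝓑 {n} A B X =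
    Σ (Mat n) λ F → Σ (Mat n) λ G → Σ (Mat n) λ H → Σ (Mat n) λ K →
    Σ (Mat n) λ θFA → Σ (Mat n) λ θFB → Σ (Mat n) λ θG → Σ (Mat n) λ θGT →
    Σ (Mat n) λ θH → Σ (Mat n) λ θKT →
      IsΘ₁ A F θFA
    × IsΘ₁ (schurInv B) F θFB
    × IsΘ A B G θG
    × IsΘ A B (G ᵀ) θGT
    × IsΘ A B H θH
    × IsΘ A (B ᵀ) (K ᵀ) θKT
    × θH ≋ (θKT ᵀ)
    × X ≋ 𝓜 θFA θFB θG θGT H K

{-# OPTIONS --safe #-}

-- The blocks of 𝓜 multiply entrywise as (θ₁ ± H₁)(θ₂ ± H₂) = (θ₁θ₂ + H₁H₂) ± (θ₁H₂ + θ₂H₁), so the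
-- Schur product of two members of 𝓑 is again one, with G = G₁G₂, H = θ₁ ∘ H₂ + θ₂ ∘ H₁ and
-- F = F₁F₂ + F₀, as soon as (Θ maps turn matrix products into Schur products)
--   (1) θ₁ ∘ H₂ ∈ 𝓝_{A,B} with Θ_{A,B}(θ₁ ∘ H₂) = F₁ᵀ Θ_{A,B}(H₂), and likewise on the B⁻-side;
--   (2) H₁ ∘ H₂ = Θ_A(F₀) and K₁ ∘ K₂ = Θ_{B⁻}(F₀) for a single matrix F₀.
-- The braid relations first make A and B type II, so that a matrix of 𝓝_{P,Q} is recovered from its
-- eigenvalues; this gives the duality Θ_{Pᵀ}(Θ_P(F)) = n Fᵀ behind (1). For (2), the braid relation lets
-- B and B⁻ exchange the Schur vectors A e_x ∘ A⁻ e_z with Schur vectors of rows (or columns) of B, while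
-- κ = Θ_{A,Bᵀ}(Kᵀ) = Θ_{A,B}(H)ᵀ exchanges them back with eigenvalue n H (resp. n K); hence
-- F₀ = n⁻³ B κ₁ B⁻ κ₂.

module Submission where

open import Data.Nat using (ℕ; zero; suc)
open import Data.Fin using (Fin; zero; suc)
open import Data.Product using (Σ; _×_; _,_; proj₁; proj₂)
open import Relation.Nullary using (¬_)
open import Relation.Binary.PropositionalEquality as ≡ using (_≡_)
import Relation.Binary.Reasoning.Setoid as SetoidReasoning
import Algebra.Properties.Semiring.Sum as SemiringSum
import Algebra.Properties.CommutativeSemigroup as CommutativeSemigroupProperties
import Algebra.Properties.Ring as RingProperties
import Algebra.Solver.Ring.NaturalCoefficients.Default as NatSolver
open import Level using (_⊔_)
import Defs

module JonesPairs {c ℓ} (K : Defs.ACField c ℓ) where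
  open Defs using (ACField; MatOn; Mat; Vect; Σ[<]; col; schurInv; NoZeroEntry; Symmetric;
                   InvertibleMat; InvertibleJonesPair; IsΘ; IsΘ₁; 𝓜; In𝓑)
  open ACField K hiding (zero)
  open SetoidReasoning setoid
  open SemiringSum semiring using (sum; sum-cong-≋; ∑-distrib-+; ∑-comm; *-distribˡ-sum)
  open CommutativeSemigroupProperties *-commutativeSemigroup
    using (x∙yz≈y∙xz; x∙yz≈xz∙y; x∙yz≈y∙zx)
  open NatSolver commutativeSemiring using (solve; _:=_; _:+_; _:*_)
  open RingProperties ring using (-‿distribˡ-*; -‿distribʳ-*; -‿involutive; -‿+-comm)

  infixl 7 _⊗_ _∘ₛ_ _∘ᵥ_ _·ᵥ_ _*ᵥ_
  infixl 6 _⊕_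
  infix  8 _ᵀ
  infix  4 _≋_ _≋ᵥ_

  _ᵀ : ∀ {n} → Mat K n → Mat K n
  _ᵀ = Defs._ᵀ K
  _⊗_ _⊕_ : ∀ {n} → Mat K n → Mat K n → Mat K n
  _⊗_ = Defs._⊗_ K
  _⊕_ = Defs._⊕_ K
  _∘ₛ_ : ∀ {I : Set} → MatOn K I → MatOn K I → MatOn K I
  _∘ₛ_ = Defs._∘ₛ_ K
  _≋_ : ∀ {I : Set} → MatOn K I → MatOn K I → Set ℓ
  _≋_ = Defs._≋_ K
  _∘ᵥ_ : ∀ {n} → Vect K n → Vect K n → Vect K n
  _∘ᵥ_ = Defs._∘ᵥ_ K
  _·ᵥ_ : ∀ {n} → Carrier → Vect K n → Vect K n
  _·ᵥ_ = Defs._·ᵥ_ K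
  _*ᵥ_ : ∀ {n} → Mat K n → Vect K n → Vect K n
  _*ᵥ_ = Defs._*ᵥ_ K
  _≋ᵥ_ : ∀ {n} → Vect K n → Vect K n → Set ℓ
  _≋ᵥ_ = Defs._≋ᵥ_ K

  ∑ : ∀ {n} → (Fin n → Carrier) → Carrier
  ∑ = Σ[<] K

  ∑≈sum : ∀ {n} (f : Fin n → Carrier) → ∑ f ≈ sum f
  ∑≈sum f = reflexive (∑≡sum f)
    where
    ∑≡sum : ∀ {n} (f : Fin n → Carrier) → ∑ f ≡ sum f
    ∑≡sum {zero}  f = ≡.refl
    ∑≡sum {suc n} f = ≡.cong (f zero +_) (∑≡sum (λ i → f (suc i)))

  ∑-cong : ∀ {n} {f g : Fin n → Carrier} → (∀ i → f i ≈ g i) → ∑ f ≈ ∑ g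
  ∑-cong {f = f} {g} f≈g = begin
    ∑ f   ≈⟨ ∑≈sum f ⟩
    sum f ≈⟨ sum-cong-≋ f≈g ⟩
    sum g ≈⟨ ∑≈sum g ⟨
    ∑ g   ∎

  ∑-+ : ∀ {n} (f g : Fin n → Carrier) → ∑ (λ i → f i + g i) ≈ ∑ f + ∑ g
  ∑-+ f g = begin
    ∑ (λ i → f i + g i)   ≈⟨ ∑≈sum (λ i → f i + g i) ⟩
    sum (λ i → f i + g i) ≈⟨ ∑-distrib-+ f g ⟩
    sum f + sum g         ≈⟨ +-cong (∑≈sum f) (∑≈sum g) ⟨
    ∑ f + ∑ g             ∎

  *-distribˡ-∑ : ∀ {n} a (f : Fin n → Carrier) → a * ∑ f ≈ ∑ (λ i → a * f i)
  *-distribˡ-∑ a f = begin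
    a * ∑ f               ≈⟨ *-congˡ (∑≈sum f) ⟩
    a * sum f             ≈⟨ *-distribˡ-sum a f ⟩
    sum (λ i → a * f i)   ≈⟨ ∑≈sum (λ i → a * f i) ⟨
    ∑ (λ i → a * f i)     ∎

  *-distribʳ-∑ : ∀ {n} a (f : Fin n → Carrier) → ∑ f * a ≈ ∑ (λ i → f i * a)
  *-distribʳ-∑ a f = begin
    ∑ f * a              ≈⟨ *-comm _ a ⟩
    a * ∑ f              ≈⟨ *-distribˡ-∑ a f ⟩
    ∑ (λ i → a * f i)    ≈⟨ ∑-cong (λ i → *-comm a (f i)) ⟩
    ∑ (λ i → f i * a)    ∎

  ∑-swap : ∀ {m n} (f : Fin m → Fin n → Carrier) → ∑ (λ i → ∑ (f i)) ≈ ∑ (λ j → ∑ (λ i → f i j))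
  ∑-swap f = begin
    ∑ (λ i → ∑ (f i))              ≈⟨ ∑-cong (λ i → ∑≈sum (f i)) ⟩
    ∑ (λ i → sum (f i))            ≈⟨ ∑≈sum (λ i → sum (f i)) ⟩
    sum (λ i → sum (f i))          ≈⟨ ∑-comm f ⟩
    sum (λ j → sum (λ i → f i j))  ≈⟨ ∑≈sum (λ j → sum (λ i → f i j)) ⟨
    ∑ (λ j → sum (λ i → f i j))    ≈⟨ ∑-cong (λ j → ∑≈sum (λ i → f i j)) ⟨
    ∑ (λ j → ∑ (λ i → f i j))      ∎

  ∑∑-assoc : ∀ {m n} (f : Fin m → Carrier) (g : Fin m → Fin n → Carrier) (h : Fin n → Carrier) →
             ∑ (λ j → ∑ (λ k → f k * g k j) * h j) ≈ ∑ (λ k → f k * ∑ (λ j → g k j * h j))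
  ∑∑-assoc f g h = begin
    ∑ (λ j → ∑ (λ k → f k * g k j) * h j)   ≈⟨ ∑-cong (λ j → *-distribʳ-∑ (h j) (λ k → f k * g k j)) ⟩
    ∑ (λ j → ∑ (λ k → f k * g k j * h j))   ≈⟨ ∑-swap (λ j k → f k * g k j * h j) ⟩
    ∑ (λ k → ∑ (λ j → f k * g k j * h j))   ≈⟨ ∑-cong (λ k → ∑-cong (λ j → *-assoc (f k) (g k j) (h j))) ⟩
    ∑ (λ k → ∑ (λ j → f k * (g k j * h j))) ≈⟨ ∑-cong (λ k → *-distribˡ-∑ (f k) (λ j → g k j * h j)) ⟨
    ∑ (λ k → f k * ∑ (λ j → g k j * h j))   ∎

  ∑-const : ∀ {n} a → ∑ {n} (λ _ → a) ≈ ofℕ n * a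
  ∑-const {zero}  a = sym (zeroˡ a)
  ∑-const {suc n} a = begin
    a + ∑ {n} (λ _ → a)  ≈⟨ +-cong (sym (*-identityˡ a)) (∑-const {n} a) ⟩
    1# * a + ofℕ n * a   ≈⟨ distribʳ a 1# (ofℕ n) ⟨
    ofℕ (suc n) * a      ∎

  δ : ∀ {n} → Fin n → Fin n → Carrier
  δ zero    zero    = 1#
  δ zero    (suc j) = 0#
  δ (suc i) zero    = 0#
  δ (suc i) (suc j) = δ i j

  δ-sym : ∀ {n} (i j : Fin n) → δ i j ≈ δ j i
  δ-sym zero    zero    = refl
  δ-sym zero    (suc j) = refl
  δ-sym (suc i) zero    = refl
  δ-sym (suc i) (suc j) = δ-sym i j

  δ-diag : ∀ {n} (i : Fin n) → δ i i ≈ 1#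
  δ-diag zero    = refl
  δ-diag (suc i) = δ-diag i

  ∑-δ : ∀ {n} (f : Fin n → Carrier) b → ∑ (λ j → f j * δ j b) ≈ f b
  ∑-δ {suc n} f zero = begin
    f zero * 1# + ∑ (λ j → f (suc j) * 0#)  ≈⟨ +-cong (*-identityʳ _) (∑-cong (λ j → zeroʳ (f (suc j)))) ⟩
    f zero + ∑ {n} (λ _ → 0#)               ≈⟨ +-congˡ (∑-const {n} 0#) ⟩
    f zero + ofℕ n * 0#                     ≈⟨ +-congˡ (zeroʳ _) ⟩
    f zero + 0#                             ≈⟨ +-identityʳ _ ⟩
    f zero                                  ∎
  ∑-δ {suc n} f (suc b) = begin
    f zero * 0# + ∑ (λ j → f (suc j) * δ j b)  ≈⟨ +-cong (zeroʳ _) (∑-δ (λ j → f (suc j)) b) ⟩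
    0# + f (suc b)                             ≈⟨ +-identityˡ _ ⟩
    f (suc b)                                  ∎

  ∑-δˡ : ∀ {n} (f : Fin n → Carrier) b → ∑ (λ j → δ b j * f j) ≈ f b
  ∑-δˡ f b = trans (∑-cong (λ j → trans (*-comm _ _) (*-congˡ (δ-sym b j)))) (∑-δ f b)

  ⁻¹-inverseˡ : ∀ {a} → ¬ a ≈ 0# → a ⁻¹ * a ≈ 1#
  ⁻¹-inverseˡ {a} a≉0 = trans (*-comm _ a) (inverseʳ a a≉0)

  *-cancelˡ : ∀ {a x y} → ¬ a ≈ 0# → a * x ≈ a * y → x ≈ y
  *-cancelˡ {a} {x} {y} a≉0 ax≈ay = begin
    x               ≈⟨ *-identityˡ x ⟨
    1# * x          ≈⟨ *-congʳ (⁻¹-inverseˡ a≉0) ⟨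
    a ⁻¹ * a * x    ≈⟨ *-assoc _ a x ⟩
    a ⁻¹ * (a * x)  ≈⟨ *-congˡ ax≈ay ⟩
    a ⁻¹ * (a * y)  ≈⟨ *-assoc _ a y ⟨
    a ⁻¹ * a * y    ≈⟨ *-congʳ (⁻¹-inverseˡ a≉0) ⟩
    1# * y          ≈⟨ *-identityˡ y ⟩
    y               ∎

  *≈1⇒≉0 : ∀ {a x} → a * x ≈ 1# → ¬ a ≈ 0#
  *≈1⇒≉0 {a} {x} ax≈1 a≈0 = 0≉1 (trans (sym (zeroˡ x)) (trans (*-congʳ (sym a≈0)) ax≈1))

  ⁻¹-unique : ∀ {a x} → a * x ≈ 1# → x ≈ a ⁻¹
  ⁻¹-unique {a} ax≈1 = *-cancelˡ (*≈1⇒≉0 ax≈1) (trans ax≈1 (sym (inverseʳ a (*≈1⇒≉0 ax≈1))))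

  ⁻¹-involutive : ∀ {a} → ¬ a ≈ 0# → a ⁻¹ ⁻¹ ≈ a
  ⁻¹-involutive a≉0 = sym (⁻¹-unique (⁻¹-inverseˡ a≉0))

  ⁻¹-cong : ∀ {a b} → ¬ a ≈ 0# → a ≈ b → a ⁻¹ ≈ b ⁻¹
  ⁻¹-cong {a} a≉0 a≈b = ⁻¹-unique (trans (*-congʳ (sym a≈b)) (inverseʳ a a≉0))

  cancel-⁻¹ : ∀ {a} b c → ¬ a ≈ 0# → a * (b * (c * a ⁻¹)) ≈ b * c
  cancel-⁻¹ {a} b c a≉0 = begin
    a * (b * (c * a ⁻¹))    ≈⟨ solve 4 (λ x y z x′ → x :* (y :* (z :* x′)) := y :* z :* (x :* x′))
                                       refl a b c (a ⁻¹) ⟩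
    b * c * (a * a ⁻¹)      ≈⟨ *-congˡ (inverseʳ a a≉0) ⟩
    b * c * 1#              ≈⟨ *-identityʳ (b * c) ⟩
    b * c                   ∎

  ofℕ-nonzero : ∀ {n} → Fin n → ¬ ofℕ n ≈ 0#
  ofℕ-nonzero {suc m} _ = charZero m

  -- `InvertibleMat` compares with an identity matrix that is local to Defs; unification recovers it.
  private
    identityOf : ∀ {n} {B D : Mat K n} →
                 (InvertibleMat K B → Σ (Mat K n) λ C → (B ⊗ C) ≋ D × (C ⊗ B) ≋ D) → Mat K n
    identityOf {D = D} _ = D

    identityᴰ : ∀ m → Mat K (suc m)
    identityᴰ m = identityOf {B = λ _ _ → 0#} (λ inverse → inverse)

    identityᴰ≈δ : ∀ m (i j : Fin (suc m)) → identityᴰ m i j ≈ δ i j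
    identityᴰ≈δ m       zero          zero          = refl
    identityᴰ≈δ m       zero          (suc j)       = refl
    identityᴰ≈δ m       (suc i)       zero          = refl
    identityᴰ≈δ (suc m) (suc zero)    (suc zero)    = refl
    identityᴰ≈δ (suc m) (suc zero)    (suc (suc j)) = refl
    identityᴰ≈δ (suc m) (suc (suc i)) (suc zero)    = refl
    identityᴰ≈δ (suc m) (suc (suc i)) (suc (suc j)) = identityᴰ≈δ m (suc i) (suc j)

  InvertibleMat⇒inverse : ∀ {n} {B : Mat K n} → InvertibleMat K B →
    Σ (Mat K n) λ C → (∀ i j → (B ⊗ C) i j ≈ δ i j) × (∀ i j → (C ⊗ B) i j ≈ δ i j)
  InvertibleMat⇒inverse {zero}  (C , _ , _)       = C , (λ ()) , (λ ())
  InvertibleMat⇒inverse {suc m} (C , BC≋I , CB≋I) =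
    C , (λ i j → trans (BC≋I i j) (identityᴰ≈δ m i j)) , (λ i j → trans (CB≋I i j) (identityᴰ≈δ m i j))

  -- Eigenvalue matrices

  ≋-refl : ∀ {I : Set} {M : MatOn K I} → M ≋ M
  ≋-refl _ _ = refl

  ≋ᵥ-refl : ∀ {n} {v : Vect K n} → v ≋ᵥ v
  ≋ᵥ-refl _ = refl

  ⊗-ᵀ : ∀ {n} (M M′ : Mat K n) → (M ⊗ M′) ᵀ ≋ M′ ᵀ ⊗ M ᵀ
  ⊗-ᵀ M M′ i j = ∑-cong (λ k → *-comm (M j k) (M′ k i))

  ᵀ⊗-pairing : ∀ {n} (F : Mat K n) {η κ : Mat K n} → η ≋ κ ᵀ → F ᵀ ⊗ η ≋ (κ ⊗ F) ᵀ
  ᵀ⊗-pairing F {η} {κ} η≋κᵀ i j = ∑-cong (λ l → trans (*-congˡ (η≋κᵀ l j)) (*-comm (F l i) (κ j l)))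

  -- `IsΘ K P Q M θ` unfolds to `∀ i j → Sends M v (θ i j) v` with `v = col P i ∘ᵥ col Q j`.
  Sends : ∀ {n} → Mat K n → Vect K n → Carrier → Vect K n → Set ℓ
  Sends M u a w = M *ᵥ u ≋ᵥ a ·ᵥ w

  Sends-cong : ∀ {n} {M M′ : Mat K n} {u u′ w w′ : Vect K n} {a a′} →
               M ≋ M′ → u ≋ᵥ u′ → a ≈ a′ → w ≋ᵥ w′ → Sends M u a w → Sends M′ u′ a′ w′
  Sends-cong {M = M} {M′} {u} {u′} {w} {w′} {a} {a′} M≋M′ u≋u′ a≈a′ w≋w′ Mu≋aw x = begin
    (M′ *ᵥ u′) x  ≈⟨ ∑-cong (λ y → *-cong (M≋M′ x y) (u≋u′ y)) ⟨
    (M *ᵥ u) x    ≈⟨ Mu≋aw x ⟩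
    a * w x       ≈⟨ *-cong a≈a′ (w≋w′ x) ⟩
    a′ * w′ x     ∎

  *ᵥ-scale : ∀ {n} (M : Mat K n) a (v : Vect K n) → M *ᵥ (a ·ᵥ v) ≋ᵥ a ·ᵥ (M *ᵥ v)
  *ᵥ-scale M a v x = trans (∑-cong (λ k → x∙yz≈y∙xz (M x k) a (v k))) (sym (*-distribˡ-∑ a (λ k → M x k * v k)))

  Sends-⊗ : ∀ {n} {M₁ M₂ : Mat K n} {u v w : Vect K n} {a b} →
            Sends M₂ u a v → Sends M₁ v b w → Sends (M₁ ⊗ M₂) u (a * b) w
  Sends-⊗ {M₁ = M₁} {M₂} {u} {v} {w} {a} {b} M₂u≋av M₁v≋bw x = begin
    ((M₁ ⊗ M₂) *ᵥ u) x    ≈⟨ ∑∑-assoc (M₁ x) M₂ u ⟩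
    (M₁ *ᵥ (M₂ *ᵥ u)) x   ≈⟨ ∑-cong (λ k → *-congˡ (M₂u≋av k)) ⟩
    (M₁ *ᵥ (a ·ᵥ v)) x    ≈⟨ *ᵥ-scale M₁ a v x ⟩
    a * (M₁ *ᵥ v) x       ≈⟨ *-congˡ (M₁v≋bw x) ⟩
    a * (b * w x)         ≈⟨ *-assoc a b (w x) ⟨
    a * b * w x           ∎

  Sends-⊕ : ∀ {n} {M M′ : Mat K n} {u w : Vect K n} {a b} →
            Sends M u a w → Sends M′ u b w → Sends (M ⊕ M′) u (a + b) w
  Sends-⊕ {M = M} {M′} {u} {w} {a} {b} Mu≋aw M′u≋bw x = begin
    ((M ⊕ M′) *ᵥ u) x                ≈⟨ ∑-cong (λ y → distribʳ (u y) (M x y) (M′ x y)) ⟩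
    ∑ (λ y → M x y * u y + M′ x y * u y) ≈⟨ ∑-+ (λ y → M x y * u y) (λ y → M′ x y * u y) ⟩
    (M *ᵥ u) x + (M′ *ᵥ u) x         ≈⟨ +-cong (Mu≋aw x) (M′u≋bw x) ⟩
    a * w x + b * w x                ≈⟨ distribʳ (w x) a b ⟨
    (a + b) * w x                    ∎

  Sends-scale : ∀ {n} {M : Mat K n} {u w : Vect K n} {a} d →
                Sends M u a w → Sends (λ x y → d * M x y) u (d * a) w
  Sends-scale {M = M} {u} {w} {a} d Mu≋aw x = begin
    ∑ (λ y → d * M x y * u y)    ≈⟨ ∑-cong (λ y → *-assoc d (M x y) (u y)) ⟩
    ∑ (λ y → d * (M x y * u y))  ≈⟨ *-distribˡ-∑ d (λ y → M x y * u y) ⟨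
    d * (M *ᵥ u) x               ≈⟨ *-congˡ (Mu≋aw x) ⟩
    d * (a * w x)                ≈⟨ *-assoc d a (w x) ⟨
    d * a * w x                  ∎

  IsΘ-cong : ∀ {n} {P P′ Q Q′ M M′ θ θ′ : Mat K n} → P ≋ P′ → Q ≋ Q′ → M ≋ M′ → θ ≋ θ′ →
             IsΘ K P Q M θ → IsΘ K P′ Q′ M′ θ′
  IsΘ-cong P≋P′ Q≋Q′ M≋M′ θ≋θ′ eigen i j =
    Sends-cong M≋M′ vectors (θ≋θ′ i j) vectors (eigen i j)
    where
    vectors = λ y → *-cong (P≋P′ y i) (Q≋Q′ y j)

  IsΘ-swap : ∀ {n} {P Q M θ : Mat K n} → IsΘ K P Q M θ → IsΘ K Q P M (θ ᵀ)
  IsΘ-swap {P = P} {Q} eigen i j = Sends-cong ≋-refl swapped refl swapped (eigen j i)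
    where
    swapped = λ y → *-comm (P y j) (Q y i)

  IsΘ-⊕ : ∀ {n} {P Q M M′ θ θ′ : Mat K n} →
          IsΘ K P Q M θ → IsΘ K P Q M′ θ′ → IsΘ K P Q (M ⊕ M′) (θ ⊕ θ′)
  IsΘ-⊕ eigen eigen′ i j = Sends-⊕ (eigen i j) (eigen′ i j)

  IsΘ-⊗ : ∀ {n} {P Q M M′ θ θ′ : Mat K n} →
          IsΘ K P Q M θ → IsΘ K P Q M′ θ′ → IsΘ K P Q (M ⊗ M′) (θ ∘ₛ θ′)
  IsΘ-⊗ eigen eigen′ i j =
    Sends-cong ≋-refl ≋ᵥ-refl (*-comm _ _) ≋ᵥ-refl (Sends-⊗ (eigen′ i j) (eigen i j))

  IsΘ-⊗ᵀ : ∀ {n} {P Q M M′ θ θ′ : Mat K n} →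
           IsΘ K P Q (M ᵀ) θ → IsΘ K P Q (M′ ᵀ) θ′ → IsΘ K P Q ((M ⊗ M′) ᵀ) (θ ∘ₛ θ′)
  IsΘ-⊗ᵀ {M = M} {M′} {θ} {θ′} eigen eigen′ =
    IsΘ-cong ≋-refl ≋-refl (λ i j → sym (⊗-ᵀ M M′ i j)) (λ i j → *-comm (θ′ i j) (θ i j)) (IsΘ-⊗ eigen′ eigen)

  RowOrthogonal : ∀ {n} → Mat K n → Mat K n → Set ℓ
  RowOrthogonal {n} P P′ = ∀ x z → ∑ (λ k → P x k * P′ z k) ≈ ofℕ n * δ x z

  RowOrthogonal-sym : ∀ {n} {P P′ : Mat K n} → RowOrthogonal P P′ → RowOrthogonal P′ P
  RowOrthogonal-sym {n} {P} {P′} orth x z = begin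
    ∑ (λ k → P′ x k * P z k)  ≈⟨ ∑-cong (λ k → *-comm (P′ x k) (P z k)) ⟩
    ∑ (λ k → P z k * P′ x k)  ≈⟨ orth z x ⟩
    ofℕ n * δ z x             ≈⟨ *-congˡ (δ-sym z x) ⟩
    ofℕ n * δ x z             ∎

  ∑-orthogonal : ∀ {n} {P P′ : Mat K n} → RowOrthogonal P P′ →
                 ∀ (f : Fin n → Carrier) z → ∑ (λ y → f y * ∑ (λ k → P y k * P′ z k)) ≈ ofℕ n * f z
  ∑-orthogonal {n} {P} {P′} orth f z = begin
    ∑ (λ y → f y * ∑ (λ k → P y k * P′ z k)) ≈⟨ ∑-cong (λ y → *-congˡ (orth y z)) ⟩
    ∑ (λ y → f y * (ofℕ n * δ y z))  ≈⟨ ∑-cong (λ y → x∙yz≈y∙xz (f y) (ofℕ n) (δ y z)) ⟩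
    ∑ (λ y → ofℕ n * (f y * δ y z))  ≈⟨ *-distribˡ-∑ (ofℕ n) (λ y → f y * δ y z) ⟨
    ofℕ n * ∑ (λ y → f y * δ y z)    ≈⟨ *-congˡ (∑-δ f z) ⟩
    ofℕ n * f z                      ∎

  rightInverse⇒RowOrthogonal : ∀ {n} {P Q P′ : Mat K n} → (∀ i j → (P ⊗ Q) i j ≈ δ i j) →
                               (∀ i j → ofℕ n * Q i j ≈ P′ j i) → RowOrthogonal P P′
  rightInverse⇒RowOrthogonal {n} {P} {Q} {P′} PQ≈I nQ≈P′ᵀ x z = begin
    ∑ (λ k → P x k * P′ z k)          ≈⟨ ∑-cong (λ k → *-congˡ (nQ≈P′ᵀ k z)) ⟨
    ∑ (λ k → P x k * (ofℕ n * Q k z)) ≈⟨ ∑-cong (λ k → x∙yz≈y∙xz (P x k) (ofℕ n) (Q k z)) ⟩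
    ∑ (λ k → ofℕ n * (P x k * Q k z)) ≈⟨ *-distribˡ-∑ (ofℕ n) (λ k → P x k * Q k z) ⟨
    ofℕ n * (P ⊗ Q) x z               ≈⟨ *-congˡ (PQ≈I x z) ⟩
    ofℕ n * δ x z                     ∎

  SchurInverse : ∀ {n} → Mat K n → Mat K n → Set ℓ
  SchurInverse P P′ = ∀ x k → P x k * P′ x k ≈ 1#

  schurInv-inverse : ∀ {n} {P : Mat K n} → NoZeroEntry K P → SchurInverse P (schurInv K P)
  schurInv-inverse {P = P} P≉0 x k = inverseʳ (P x k) (P≉0 x k)

  -- Fixing j, the vectors col P i ∘ col Q j form an eigenbasis of M, which determines M from θ.
  IsΘ-reconstruct : ∀ {n} {P P′ Q M θ : Mat K n} → RowOrthogonal P P′ → IsΘ K P Q M θ →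
                    ∀ x z j → Q x j * ∑ (λ i → θ i j * (P x i * P′ z i)) ≈ ofℕ n * (M x z * Q z j)
  IsΘ-reconstruct {n} {P} {P′} {Q} {M} {θ} orth eigen x z j = begin
    Q x j * ∑ (λ i → θ i j * (P x i * P′ z i))
      ≈⟨ *-distribˡ-∑ (Q x j) (λ i → θ i j * (P x i * P′ z i)) ⟩
    ∑ (λ i → Q x j * (θ i j * (P x i * P′ z i)))
      ≈⟨ ∑-cong (λ i → solve 4 (λ q t p p′ → q :* (t :* (p :* p′)) := t :* (p :* q) :* p′)
                               refl (Q x j) (θ i j) (P x i) (P′ z i)) ⟩
    ∑ (λ i → θ i j * (P x i * Q x j) * P′ z i)
      ≈⟨ ∑-cong (λ i → *-congʳ (eigen i j x)) ⟨
    ∑ (λ i → ∑ (λ y → M x y * (P y i * Q y j)) * P′ z i)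
      ≈⟨ ∑-cong (λ i → *-congʳ (∑-cong (λ y → trans (*-congˡ (*-comm (P y i) (Q y j)))
                                                      (sym (*-assoc (M x y) (Q y j) (P y i)))))) ⟩
    ∑ (λ i → ∑ (λ y → M x y * Q y j * P y i) * P′ z i)
      ≈⟨ ∑∑-assoc (λ y → M x y * Q y j) P (P′ z) ⟩
    ∑ (λ y → M x y * Q y j * ∑ (λ i → P y i * P′ z i))
      ≈⟨ ∑-orthogonal orth (λ y → M x y * Q y j) z ⟩
    ofℕ n * (M x z * Q z j)
      ∎

  IsΘ-sendsᵀ : ∀ {n} {P P′ Q Q′ M θ : Mat K n} → RowOrthogonal P P′ → SchurInverse Q Q′ →
               IsΘ K P Q M θ → ∀ x z → Sends (θ ᵀ) (P x ∘ᵥ P′ z) (ofℕ n * M x z) (Q z ∘ᵥ Q′ x)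
  IsΘ-sendsᵀ {n} {P} {P′} {Q} {Q′} {M} {θ} orth inverse eigen x z j = begin
    Σθ                            ≈⟨ *-identityˡ Σθ ⟨
    1# * Σθ                       ≈⟨ *-congʳ (trans (*-comm (Q′ x j) (Q x j)) (inverse x j)) ⟨
    Q′ x j * Q x j * Σθ           ≈⟨ *-assoc (Q′ x j) (Q x j) Σθ ⟩
    Q′ x j * (Q x j * Σθ)         ≈⟨ *-congˡ (IsΘ-reconstruct orth eigen x z j) ⟩
    Q′ x j * (ofℕ n * (M x z * Q z j))
      ≈⟨ solve 4 (λ q′ m a q → q′ :* (m :* (a :* q)) := m :* a :* (q :* q′))
                 refl (Q′ x j) (ofℕ n) (M x z) (Q z j) ⟩
    ofℕ n * M x z * (Q z j * Q′ x j) ∎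
    where
    Σθ = ∑ (λ i → θ i j * (P x i * P′ z i))

  IsΘ-dual : ∀ {n} {P P′ M θ : Mat K n} → RowOrthogonal P P′ → SchurInverse P′ P →
             IsΘ K P P′ M θ → IsΘ K (P ᵀ) (P′ ᵀ) (θ ᵀ) (λ x z → ofℕ n * M x z)
  IsΘ-dual {P = P} {P′} orth inverse eigen x z =
    Sends-cong ≋-refl ≋ᵥ-refl refl (λ j → *-comm (P′ z j) (P x j)) (IsΘ-sendsᵀ orth inverse eigen x z)

  Sends-invertᵀ : ∀ {n} {P P′ : Mat K n} {u v : Vect K n} {a} → RowOrthogonal P P′ → ¬ a ≈ 0# →
                  Sends (P ᵀ) v (ofℕ n * a) u → Sends P′ u (a ⁻¹) v
  Sends-invertᵀ {n} {P} {P′} {u} {v} {a} orth a≉0 Pᵀv≋au y =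
    *-cancelˡ a≉0 (trans (*-cancelˡ (ofℕ-nonzero y) scaled) (sym a[a⁻¹v]≈v))
    where
    scaled : ofℕ n * (a * (P′ *ᵥ u) y) ≈ ofℕ n * v y
    scaled = begin
      ofℕ n * (a * (P′ *ᵥ u) y)               ≈⟨ *-assoc (ofℕ n) a _ ⟨
      ofℕ n * a * ∑ (λ j → P′ y j * u j)      ≈⟨ *-distribˡ-∑ (ofℕ n * a) (λ j → P′ y j * u j) ⟩
      ∑ (λ j → ofℕ n * a * (P′ y j * u j))    ≈⟨ ∑-cong (λ j → x∙yz≈xz∙y (ofℕ n * a) (P′ y j) (u j)) ⟩
      ∑ (λ j → ofℕ n * a * u j * P′ y j)      ≈⟨ ∑-cong (λ j → *-congʳ (Pᵀv≋au j)) ⟨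
      ∑ (λ j → ∑ (λ i → P i j * v i) * P′ y j) ≈⟨ ∑-cong (λ j → *-congʳ (∑-cong (λ i → *-comm (P i j) (v i)))) ⟩
      ∑ (λ j → ∑ (λ i → v i * P i j) * P′ y j) ≈⟨ ∑∑-assoc v P (P′ y) ⟩
      ∑ (λ i → v i * ∑ (λ j → P i j * P′ y j)) ≈⟨ ∑-orthogonal orth v y ⟩
      ofℕ n * v y                              ∎
    a[a⁻¹v]≈v : a * (a ⁻¹ * v y) ≈ v y
    a[a⁻¹v]≈v = trans (sym (*-assoc a (a ⁻¹) (v y))) (trans (*-congʳ (inverseʳ a a≉0)) (*-identityˡ (v y)))

  -- Expand H through IsΘ-reconstruct; φ then acts on the vectors P x ∘ P′ y through its own eigenvalues.
  IsΘ-schur : ∀ {n} {P P′ Q F φ H η : Mat K n} → RowOrthogonal P P′ → SchurInverse P P′ →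
              IsΘ K P P′ φ (λ i l → ofℕ n * F l i) → IsΘ K P Q H η → IsΘ K P Q (φ ∘ₛ H) (F ᵀ ⊗ η)
  IsΘ-schur {n} {P} {P′} {Q} {F} {φ} {H} {η} orth inverse eigenφ eigenH i j x =
    *-cancelˡ (ofℕ-nonzero x) (begin
      N * ∑ (λ y → φ x y * H x y * (P y i * Q y j))
        ≈⟨ *-distribˡ-∑ N (λ y → φ x y * H x y * (P y i * Q y j)) ⟩
      ∑ (λ y → N * (φ x y * H x y * (P y i * Q y j)))
        ≈⟨ ∑-cong (λ y → solve 5 (λ m f h p q → m :* (f :* h :* (p :* q)) := f :* p :* (m :* (h :* q)))
                                 refl N (φ x y) (H x y) (P y i) (Q y j)) ⟩
      ∑ (λ y → φ x y * P y i * (N * (H x y * Q y j)))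
        ≈⟨ ∑-cong (λ y → *-congˡ (IsΘ-reconstruct orth eigenH x y j)) ⟨
      ∑ (λ y → φ x y * P y i * (Q x j * ∑ (λ l → η l j * (P x l * P′ y l))))
        ≈⟨ ∑-cong (λ y → x∙yz≈y∙zx (φ x y * P y i) (Q x j) _) ⟩
      ∑ (λ y → Q x j * (∑ (λ l → η l j * (P x l * P′ y l)) * (φ x y * P y i)))
        ≈⟨ *-distribˡ-∑ (Q x j) (λ y → ∑ (λ l → η l j * (P x l * P′ y l)) * (φ x y * P y i)) ⟨
      Q x j * ∑ (λ y → ∑ (λ l → η l j * (P x l * P′ y l)) * (φ x y * P y i))
        ≈⟨ *-congˡ (∑-cong (λ y → *-congʳ (∑-cong (λ l → sym (*-assoc (η l j) (P x l) (P′ y l)))))) ⟩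
      Q x j * ∑ (λ y → ∑ (λ l → η l j * P x l * P′ y l) * (φ x y * P y i))
        ≈⟨ *-congˡ (∑∑-assoc (λ l → η l j * P x l) (λ l y → P′ y l) (λ y → φ x y * P y i)) ⟩
      Q x j * ∑ (λ l → η l j * P x l * ∑ (λ y → P′ y l * (φ x y * P y i)))
        ≈⟨ *-congˡ (∑-cong (λ l → *-congˡ (trans (∑-cong (λ y → x∙yz≈y∙zx (P′ y l) (φ x y) (P y i)))
                                                   (eigenφ i l x)))) ⟩
      Q x j * ∑ (λ l → η l j * P x l * (N * F l i * (P x i * P′ x l)))
        ≈⟨ *-congˡ (∑-cong (λ l → cancelled l)) ⟩
      Q x j * ∑ (λ l → N * P x i * (F l i * η l j))
        ≈⟨ *-congˡ (*-distribˡ-∑ (N * P x i) (λ l → F l i * η l j)) ⟨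
      Q x j * (N * P x i * (F ᵀ ⊗ η) i j)
        ≈⟨ solve 4 (λ q m p s → q :* (m :* p :* s) := m :* (s :* (p :* q))) refl (Q x j) N (P x i) _ ⟩
      N * ((F ᵀ ⊗ η) i j * (P x i * Q x j)) ∎)
    where
    N = ofℕ n
    cancelled : ∀ l → η l j * P x l * (N * F l i * (P x i * P′ x l)) ≈ N * P x i * (F l i * η l j)
    cancelled l = begin
      η l j * P x l * (N * F l i * (P x i * P′ x l))
        ≈⟨ solve 6 (λ e p m f q p′ → e :* p :* (m :* f :* (q :* p′)) := m :* q :* (f :* e) :* (p :* p′))
                   refl (η l j) (P x l) N (F l i) (P x i) (P′ x l) ⟩
      N * P x i * (F l i * η l j) * (P x l * P′ x l)
        ≈⟨ *-congˡ (inverse x l) ⟩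
      N * P x i * (F l i * η l j) * 1#
        ≈⟨ *-identityʳ _ ⟩
      N * P x i * (F l i * η l j) ∎

  [x+h]*[y+k] : ∀ x h y k → (x + h) * (y + k) ≈ x * y + h * k + (x * k + y * h)
  [x+h]*[y+k] = solve 4 (λ x h y k → (x :+ h) :* (y :+ k) := x :* y :+ h :* k :+ (x :* k :+ y :* h)) refl

  [x-h]*[y-k] : ∀ x h y k → (x - h) * (y - k) ≈ x * y + h * k - (x * k + y * h)
  [x-h]*[y-k] x h y k = begin
    (x - h) * (y - k)                          ≈⟨ [x+h]*[y+k] x (- h) y (- k) ⟩
    x * y + - h * - k + (x * - k + y * - h)    ≈⟨ +-cong (+-congˡ -h*-k≈hk) -[xk+yh] ⟩
    x * y + h * k - (x * k + y * h)            ∎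
    where
    -h*-k≈hk : - h * - k ≈ h * k
    -h*-k≈hk = trans (sym (-‿distribˡ-* h (- k)))
                     (trans (-‿cong (sym (-‿distribʳ-* h k))) (-‿involutive (h * k)))
    -[xk+yh] : x * - k + y * - h ≈ - (x * k + y * h)
    -[xk+yh] = trans (+-cong (sym (-‿distribʳ-* x k)) (sym (-‿distribʳ-* y h))) (-‿+-comm (x * k) (y * h))

  𝓜-∘ₛ : ∀ {n} {a₁ b₁ g₁ t₁ h₁ k₁ a₂ b₂ g₂ t₂ h₂ k₂ : Mat K n} →
         𝓜 K a₁ b₁ g₁ t₁ h₁ k₁ ∘ₛ 𝓜 K a₂ b₂ g₂ t₂ h₂ k₂ ≋
         𝓜 K (a₁ ∘ₛ a₂ ⊕ h₁ ∘ₛ h₂) (b₁ ∘ₛ b₂ ⊕ k₁ ∘ₛ k₂) (g₁ ∘ₛ g₂) (t₁ ∘ₛ t₂)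
             (a₁ ∘ₛ h₂ ⊕ a₂ ∘ₛ h₁) (b₁ ∘ₛ k₂ ⊕ b₂ ∘ₛ k₁)
  𝓜-∘ₛ (zero , _)                  (zero , _)                = [x+h]*[y+k] _ _ _ _
  𝓜-∘ₛ (zero , _)                  (suc zero , _)            = [x-h]*[y-k] _ _ _ _
  𝓜-∘ₛ (suc zero , _)              (zero , _)                = [x-h]*[y-k] _ _ _ _
  𝓜-∘ₛ (suc zero , _)              (suc zero , _)            = [x+h]*[y+k] _ _ _ _
  𝓜-∘ₛ (zero , _)                  (suc (suc _) , _)         = refl
  𝓜-∘ₛ (suc zero , _)              (suc (suc _) , _)         = refl
  𝓜-∘ₛ (suc (suc _) , _)           (zero , _)                = refl
  𝓜-∘ₛ (suc (suc _) , _)           (suc zero , _)            = refl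
  𝓜-∘ₛ (suc (suc zero) , _)        (suc (suc zero) , _)      = [x+h]*[y+k] _ _ _ _
  𝓜-∘ₛ (suc (suc zero) , _)        (suc (suc (suc _)) , _)   = [x-h]*[y-k] _ _ _ _
  𝓜-∘ₛ (suc (suc (suc _)) , _)     (suc (suc zero) , _)      = [x-h]*[y-k] _ _ _ _
  𝓜-∘ₛ (suc (suc (suc _)) , _)     (suc (suc (suc _)) , _)   = [x+h]*[y+k] _ _ _ _

  -- Jones pairs

  Braids : ∀ {n} → Mat K n → Mat K n → Set (c ⊔ ℓ)
  Braids A B = ∀ M → A ⊗ (B ∘ₛ (A ⊗ M)) ≋ B ∘ₛ (A ⊗ (B ∘ₛ M))

  braid-entries : ∀ {n} {A B : Mat K n} → Braids A B →
                  ∀ a b j → ∑ (λ k → A a k * (B k j * A k b)) ≈ B a j * (A a b * B b j)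
  braid-entries {A = A} {B} braid a b j = begin
    ∑ (λ k → A a k * (B k j * A k b))
      ≈⟨ ∑-cong (λ k → *-congˡ (*-congˡ (∑-δ (A k) b))) ⟨
    (A ⊗ (B ∘ₛ (A ⊗ Eᵇ))) a j
      ≈⟨ braid Eᵇ a j ⟩
    B a j * ∑ (λ k → A a k * (B k j * δ k b))
      ≈⟨ *-congˡ (trans (∑-cong (λ k → sym (*-assoc (A a k) (B k j) (δ k b)))) (∑-δ (λ k → A a k * B k j) b)) ⟩
    B a j * (A a b * B b j) ∎
    where
    Eᵇ : Mat K _
    Eᵇ l _ = δ l b

  module BraidWithInverse {n} {A B C : Mat K n} (braid : Braids A B) (A≉0 : NoZeroEntry K A)
                          (BC≈I : ∀ i j → (B ⊗ C) i j ≈ δ i j) (CB≈I : ∀ i j → (C ⊗ B) i j ≈ δ i j) where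

    diagonal-formula : ∀ a y → A y y ≈ ∑ (λ j → B a j * (B y j * C j y))
    diagonal-formula a y = *-cancelˡ (A≉0 a y) (begin
      A a y * A y y
        ≈⟨ ∑-δ (λ k → A a k * A k y) y ⟨
      ∑ (λ k → A a k * A k y * δ k y)
        ≈⟨ ∑-cong (λ k → *-congˡ (BC≈I k y)) ⟨
      ∑ (λ k → A a k * A k y * ∑ (λ j → B k j * C j y))
        ≈⟨ ∑∑-assoc (λ k → A a k * A k y) B (λ j → C j y) ⟨
      ∑ (λ j → ∑ (λ k → A a k * A k y * B k j) * C j y)
        ≈⟨ ∑-cong (λ j → *-congʳ (trans (∑-cong (λ k → solve 3 (λ p q r → p :* q :* r := p :* (r :* q))
                                                               refl (A a k) (A k y) (B k j)))
                                        (braid-entries braid a y j))) ⟩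
      ∑ (λ j → B a j * (A a y * B y j) * C j y)
        ≈⟨ ∑-cong (λ j → solve 4 (λ p q r u → p :* (q :* r) :* u := q :* (p :* (r :* u)))
                                 refl (B a j) (A a y) (B y j) (C j y)) ⟩
      ∑ (λ j → A a y * (B a j * (B y j * C j y)))
        ≈⟨ *-distribˡ-∑ (A a y) (λ j → B a j * (B y j * C j y)) ⟨
      A a y * ∑ (λ j → B a j * (B y j * C j y)) ∎)

    B*C≈diagonal*rowSum : ∀ y k → B y k * C k y ≈ A y y * ∑ (C k)
    B*C≈diagonal*rowSum y k = begin
      B y k * C k y
        ≈⟨ ∑-δˡ (λ j → B y j * C j y) k ⟨
      ∑ (λ j → δ k j * (B y j * C j y))
        ≈⟨ ∑-cong (λ j → *-congʳ (CB≈I k j)) ⟨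
      ∑ (λ j → ∑ (λ a → C k a * B a j) * (B y j * C j y))
        ≈⟨ ∑∑-assoc (C k) B (λ j → B y j * C j y) ⟩
      ∑ (λ a → C k a * ∑ (λ j → B a j * (B y j * C j y)))
        ≈⟨ ∑-cong (λ a → *-congˡ (diagonal-formula a y)) ⟨
      ∑ (λ a → C k a * A y y)
        ≈⟨ *-distribʳ-∑ (A y y) (C k) ⟨
      ∑ (C k) * A y y
        ≈⟨ *-comm _ _ ⟩
      A y y * ∑ (C k) ∎

    trace*rowSum≈1 : ∀ k → ∑ (λ y → A y y) * ∑ (C k) ≈ 1#
    trace*rowSum≈1 k = begin
      ∑ (λ y → A y y) * ∑ (C k)    ≈⟨ *-distribʳ-∑ (∑ (C k)) (λ y → A y y) ⟩
      ∑ (λ y → A y y * ∑ (C k))    ≈⟨ ∑-cong (λ y → trans (*-comm (C k y) (B y k)) (B*C≈diagonal*rowSum y k)) ⟨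
      (C ⊗ B) k k                  ≈⟨ CB≈I k k ⟩
      δ k k                        ≈⟨ δ-diag k ⟩
      1#                           ∎

  -- Contracting the braid relations for B and Bᵀ with C = B⁻¹ shows that A has a constant diagonal d
  -- with B y k * C k y = d * (row sum of C), whence n C = B⁻ᵀ; A's right inverse R is handled alike.
  module TypeII {n} {A B : Mat K n} (pair : InvertibleJonesPair K A B) where

    braid : Braids A B
    braid = proj₁ (proj₂ (proj₂ (proj₁ pair)))

    braidᵀ : Braids A (B ᵀ)
    braidᵀ = proj₂ (proj₂ (proj₂ (proj₁ pair)))

    A≉0 : NoZeroEntry K A
    A≉0 = proj₁ (proj₂ pair)

    B≉0 : NoZeroEntry K B
    B≉0 i j = *≈1⇒≉0 (proj₁ (proj₂ (proj₁ (proj₂ (proj₁ pair)))) (λ _ _ → 1#) i j)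

    private
      N : Carrier
      N = ofℕ n

      R : Mat K n
      R = proj₁ (proj₁ (proj₁ pair)) (λ i j → δ i j)

      A⊗R≈I : ∀ i j → (A ⊗ R) i j ≈ δ i j
      A⊗R≈I = proj₁ (proj₂ (proj₁ (proj₁ pair))) (λ i j → δ i j)

      C : Mat K n
      C = proj₁ (InvertibleMat⇒inverse (proj₂ (proj₂ pair)))

      B⊗C≈I : ∀ i j → (B ⊗ C) i j ≈ δ i j
      B⊗C≈I = proj₁ (proj₂ (InvertibleMat⇒inverse (proj₂ (proj₂ pair))))

      C⊗B≈I : ∀ i j → (C ⊗ B) i j ≈ δ i j
      C⊗B≈I = proj₂ (proj₂ (InvertibleMat⇒inverse (proj₂ (proj₂ pair))))

      Bᵀ⊗Cᵀ≈I : ∀ i j → (B ᵀ ⊗ C ᵀ) i j ≈ δ i j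
      Bᵀ⊗Cᵀ≈I i j = trans (sym (⊗-ᵀ C B i j)) (trans (C⊗B≈I j i) (δ-sym j i))

      Cᵀ⊗Bᵀ≈I : ∀ i j → (C ᵀ ⊗ B ᵀ) i j ≈ δ i j
      Cᵀ⊗Bᵀ≈I i j = trans (sym (⊗-ᵀ B C i j)) (trans (B⊗C≈I j i) (δ-sym j i))

      module Rows = BraidWithInverse braid A≉0 B⊗C≈I C⊗B≈I
      module Cols = BraidWithInverse braidᵀ A≉0 Bᵀ⊗Cᵀ≈I Cᵀ⊗Bᵀ≈I

      trace : Carrier
      trace = ∑ (λ y → A y y)

      diagonal-constant : ∀ i j → A i i ≈ A j j
      diagonal-constant i j = begin
        A i i                          ≈⟨ *-identityʳ (A i i) ⟨
        A i i * 1#                     ≈⟨ *-congˡ (Rows.trace*rowSum≈1 j) ⟨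
        A i i * (trace * ∑ (C j))      ≈⟨ x∙yz≈y∙xz (A i i) trace (∑ (C j)) ⟩
        trace * (A i i * ∑ (C j))      ≈⟨ *-congˡ (Rows.B*C≈diagonal*rowSum i j) ⟨
        trace * (B i j * C j i)        ≈⟨ *-congˡ (Cols.B*C≈diagonal*rowSum j i) ⟩
        trace * (A j j * ∑ ((C ᵀ) i))    ≈⟨ x∙yz≈y∙xz trace (A j j) (∑ ((C ᵀ) i)) ⟩
        A j j * (trace * ∑ ((C ᵀ) i))    ≈⟨ *-congˡ (Cols.trace*rowSum≈1 i) ⟩
        A j j * 1#                     ≈⟨ *-identityʳ (A j j) ⟩
        A j j                          ∎

      trace≈N*diagonal : ∀ x → trace ≈ N * A x x
      trace≈N*diagonal x = trans (∑-cong (λ y → diagonal-constant y x)) (∑-const {n} (A x x))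

      N*C≈B⁻ᵀ : ∀ i j → N * C i j ≈ B j i ⁻¹
      N*C≈B⁻ᵀ i j = ⁻¹-unique (begin
        B j i * (N * C i j)      ≈⟨ x∙yz≈y∙xz (B j i) N (C i j) ⟩
        N * (B j i * C i j)      ≈⟨ *-congˡ (Rows.B*C≈diagonal*rowSum j i) ⟩
        N * (A j j * ∑ (C i))    ≈⟨ *-assoc N (A j j) (∑ (C i)) ⟨
        N * A j j * ∑ (C i)      ≈⟨ *-congʳ (trace≈N*diagonal j) ⟨
        trace * ∑ (C i)          ≈⟨ Rows.trace*rowSum≈1 i ⟩
        1#                       ∎)

      braid-R : ∀ z k → ∑ (λ b → A z b * R b z * B b k) ≈ A z z
      braid-R z k = *-cancelˡ (B≉0 z k) (begin
        B z k * ∑ (λ b → A z b * R b z * B b k)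
          ≈⟨ *-distribˡ-∑ (B z k) (λ b → A z b * R b z * B b k) ⟩
        ∑ (λ b → B z k * (A z b * R b z * B b k))
          ≈⟨ ∑-cong (λ b → solve 4 (λ p q r u → p :* (q :* r :* u) := p :* (q :* u) :* r)
                                   refl (B z k) (A z b) (R b z) (B b k)) ⟩
        ∑ (λ b → B z k * (A z b * B b k) * R b z)
          ≈⟨ ∑-cong (λ b → *-congʳ (braid-entries braid z b k)) ⟨
        ∑ (λ b → ∑ (λ x → A z x * (B x k * A x b)) * R b z)
          ≈⟨ ∑-cong (λ b → *-congʳ (∑-cong (λ x → sym (*-assoc (A z x) (B x k) (A x b))))) ⟩
        ∑ (λ b → ∑ (λ x → A z x * B x k * A x b) * R b z)
          ≈⟨ ∑∑-assoc (λ x → A z x * B x k) A (λ b → R b z) ⟩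
        ∑ (λ x → A z x * B x k * (A ⊗ R) x z)
          ≈⟨ ∑-cong (λ x → *-congˡ (A⊗R≈I x z)) ⟩
        ∑ (λ x → A z x * B x k * δ x z)
          ≈⟨ ∑-δ (λ x → A z x * B x k) z ⟩
        A z z * B z k
          ≈⟨ *-comm (A z z) (B z k) ⟩
        B z k * A z z ∎)

      A*R≈diagonal*colSum : ∀ z w → A z w * R w z ≈ A z z * ∑ ((C ᵀ) w)
      A*R≈diagonal*colSum z w = begin
        A z w * R w z
          ≈⟨ ∑-δ (λ b → A z b * R b z) w ⟨
        ∑ (λ b → A z b * R b z * δ b w)
          ≈⟨ ∑-cong (λ b → *-congˡ (B⊗C≈I b w)) ⟨
        ∑ (λ b → A z b * R b z * (B ⊗ C) b w)
          ≈⟨ ∑∑-assoc (λ b → A z b * R b z) B (λ k → C k w) ⟨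
        ∑ (λ k → ∑ (λ b → A z b * R b z * B b k) * C k w)
          ≈⟨ ∑-cong (λ k → *-congʳ (braid-R z k)) ⟩
        ∑ (λ k → A z z * C k w)
          ≈⟨ *-distribˡ-∑ (A z z) ((C ᵀ) w) ⟨
        A z z * ∑ ((C ᵀ) w) ∎

      N*R≈A⁻ᵀ : ∀ w z → N * R w z ≈ A z w ⁻¹
      N*R≈A⁻ᵀ w z = ⁻¹-unique (begin
        A z w * (N * R w z)      ≈⟨ x∙yz≈y∙xz (A z w) N (R w z) ⟩
        N * (A z w * R w z)      ≈⟨ *-congˡ (A*R≈diagonal*colSum z w) ⟩
        N * (A z z * ∑ ((C ᵀ) w))  ≈⟨ *-assoc N (A z z) (∑ ((C ᵀ) w)) ⟨
        N * A z z * ∑ ((C ᵀ) w)    ≈⟨ *-congʳ (trace≈N*diagonal z) ⟨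
        trace * ∑ ((C ᵀ) w)        ≈⟨ Cols.trace*rowSum≈1 w ⟩
        1#                       ∎)

    A-orthogonal : RowOrthogonal A (schurInv K A)
    A-orthogonal = rightInverse⇒RowOrthogonal A⊗R≈I N*R≈A⁻ᵀ

    B-orthogonal : RowOrthogonal B (schurInv K B)
    B-orthogonal = rightInverse⇒RowOrthogonal B⊗C≈I N*C≈B⁻ᵀ

    Bᵀ-orthogonal : RowOrthogonal (B ᵀ) (schurInv K B ᵀ)
    Bᵀ-orthogonal = rightInverse⇒RowOrthogonal Bᵀ⊗Cᵀ≈I (λ i j → N*C≈B⁻ᵀ j i)

  module BraidOnSchurVectors {n} {A B : Mat K n} (braid : Braids A B) (symA : Symmetric K A)
                             (A≉0 : NoZeroEntry K A) (B≉0 : NoZeroEntry K B)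
                             (A-orthogonal : RowOrthogonal A (schurInv K A))
                             (B-orthogonal : RowOrthogonal B (schurInv K B)) where

    private
      N : Carrier
      N = ofℕ n

      A⁻ B⁻ : Mat K n
      A⁻ = schurInv K A
      B⁻ = schurInv K B

    ᵀ-sends-A∘A⁻ : ∀ x z → Sends (B ᵀ) (A x ∘ᵥ A⁻ z) (N * A x z) (B z ∘ᵥ B⁻ x)
    ᵀ-sends-A∘A⁻ x z j = *-cancelˡ (B≉0 x j) (begin
      B x j * ∑ (λ i → B i j * (A x i * A⁻ z i))
        ≈⟨ *-distribˡ-∑ (B x j) (λ i → B i j * (A x i * A⁻ z i)) ⟩
      ∑ (λ i → B x j * (B i j * (A x i * A⁻ z i)))
        ≈⟨ ∑-cong (λ i → solve 4 (λ b b′ a a′ → b :* (b′ :* (a :* a′)) := b :* (a :* b′) :* a′)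
                                 refl (B x j) (B i j) (A x i) (A⁻ z i)) ⟩
      ∑ (λ i → B x j * (A x i * B i j) * A⁻ z i)
        ≈⟨ ∑-cong (λ i → *-congʳ (braid-entries braid x i j)) ⟨
      ∑ (λ i → ∑ (λ y → A x y * (B y j * A y i)) * A⁻ z i)
        ≈⟨ ∑-cong (λ i → *-congʳ (∑-cong (λ y → sym (*-assoc (A x y) (B y j) (A y i))))) ⟩
      ∑ (λ i → ∑ (λ y → A x y * B y j * A y i) * A⁻ z i)
        ≈⟨ ∑∑-assoc (λ y → A x y * B y j) A (A⁻ z) ⟩
      ∑ (λ y → A x y * B y j * ∑ (λ i → A y i * A⁻ z i))
        ≈⟨ ∑-orthogonal A-orthogonal (λ y → A x y * B y j) z ⟩
      N * (A x z * B z j)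
        ≈⟨ *-assoc N (A x z) (B z j) ⟨
      N * A x z * B z j
        ≈⟨ cancel-⁻¹ (N * A x z) (B z j) (B≉0 x j) ⟨
      B x j * (N * A x z * (B z j * B⁻ x j)) ∎)

    sends-B∘B⁻ : ∀ x z → Sends B (B z ∘ᵥ B⁻ x) (N * A x z) (A x ∘ᵥ A⁻ z)
    sends-B∘B⁻ x z y = *-cancelˡ (A≉0 y z) (begin
      A y z * ∑ (λ j → B y j * (B z j * B⁻ x j))
        ≈⟨ *-distribˡ-∑ (A y z) (λ j → B y j * (B z j * B⁻ x j)) ⟩
      ∑ (λ j → A y z * (B y j * (B z j * B⁻ x j)))
        ≈⟨ ∑-cong (λ j → solve 4 (λ a b b′ b″ → a :* (b :* (b′ :* b″)) := b :* (a :* b′) :* b″)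
                                 refl (A y z) (B y j) (B z j) (B⁻ x j)) ⟩
      ∑ (λ j → B y j * (A y z * B z j) * B⁻ x j)
        ≈⟨ ∑-cong (λ j → *-congʳ (braid-entries braid y z j)) ⟨
      ∑ (λ j → ∑ (λ w → A y w * (B w j * A w z)) * B⁻ x j)
        ≈⟨ ∑-cong (λ j → *-congʳ (∑-cong (λ w → solve 3 (λ a b a′ → a :* (b :* a′) := a :* a′ :* b)
                                                        refl (A y w) (B w j) (A w z)))) ⟩
      ∑ (λ j → ∑ (λ w → A y w * A w z * B w j) * B⁻ x j)
        ≈⟨ ∑∑-assoc (λ w → A y w * A w z) B (B⁻ x) ⟩
      ∑ (λ w → A y w * A w z * ∑ (λ j → B w j * B⁻ x j))
        ≈⟨ ∑-orthogonal B-orthogonal (λ w → A y w * A w z) x ⟩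
      N * (A y x * A x z)
        ≈⟨ *-congˡ (*-congʳ (symA y x)) ⟩
      N * (A x y * A x z)
        ≈⟨ solve 3 (λ m p q → m :* (p :* q) := m :* q :* p) refl N (A x y) (A x z) ⟩
      N * A x z * A x y
        ≈⟨ cancel-⁻¹ (N * A x z) (A x y) (A≉0 y z) ⟨
      A y z * (N * A x z * (A x y * A y z ⁻¹))
        ≈⟨ *-congˡ (*-congˡ (*-congˡ (⁻¹-cong (A≉0 y z) (symA y z)))) ⟩
      A y z * (N * A x z * (A x y * A⁻ z y)) ∎)

  module SymmetricInvertibleJonesPair {n} {A B : Mat K n} (pair : InvertibleJonesPair K A B)
                                      (symA : Symmetric K A) where
    open TypeII pair

    private
      N : Carrier
      N = ofℕ n

      A⁻ B⁻ : Mat K n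
      A⁻ = schurInv K A
      B⁻ = schurInv K B

      A-inverse : SchurInverse A A⁻
      A-inverse = schurInv-inverse A≉0

      B-inverse : SchurInverse B B⁻
      B-inverse = schurInv-inverse B≉0

      Bᵀ-inverse : SchurInverse (B ᵀ) (B⁻ ᵀ)
      Bᵀ-inverse x k = B-inverse k x

      Bᵀ≉0 : NoZeroEntry K (B ᵀ)
      Bᵀ≉0 i j = B≉0 j i

      module ForB  = BraidOnSchurVectors braid symA A≉0 B≉0 A-orthogonal B-orthogonal
      module ForBᵀ = BraidOnSchurVectors braidᵀ symA A≉0 Bᵀ≉0 A-orthogonal Bᵀ-orthogonal

      B-sends-B-rows : ∀ x z → Sends B (B z ∘ᵥ B⁻ x) (N * A x z) (A x ∘ᵥ A⁻ z)
      B-sends-B-rows = ForB.sends-B∘B⁻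

      B⁻-sends-B-rows : ∀ x z → Sends B⁻ (B z ∘ᵥ B⁻ x) (A x z ⁻¹) (A x ∘ᵥ A⁻ z)
      B⁻-sends-B-rows x z = Sends-invertᵀ B-orthogonal (A≉0 x z) (ForB.ᵀ-sends-A∘A⁻ x z)

      B-sends-A-rows : ∀ x z → Sends B (A x ∘ᵥ A⁻ z) (N * A x z) (col K B z ∘ᵥ col K B⁻ x)
      B-sends-A-rows = ForBᵀ.ᵀ-sends-A∘A⁻

      B⁻-sends-A-rows : ∀ x z → Sends B⁻ (A x ∘ᵥ A⁻ z) (A x z ⁻¹) (col K B z ∘ᵥ col K B⁻ x)
      B⁻-sends-A-rows x z = Sends-invertᵀ B-orthogonal (A≉0 x z) (ForBᵀ.sends-B∘B⁻ x z)

    F₀ : Mat K n → Mat K n → Mat K n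
    F₀ κ₁ κ₂ x y = N ⁻¹ * (N ⁻¹ * N ⁻¹) * (B ⊗ (κ₁ ⊗ (B⁻ ⊗ κ₂))) x y

    F₀-sends : ∀ {κ₁ κ₂ : Mat K n} {v w : Vect K n} {h₁ h₂ a} → ¬ a ≈ 0# →
               Sends κ₁ v (N * h₁) w → Sends κ₂ v (N * h₂) w →
               Sends B⁻ w (a ⁻¹) v → Sends B w (N * a) v → Sends (F₀ κ₁ κ₂) v (h₁ * h₂) v
    F₀-sends {h₁ = h₁} {h₂} {a} a≉0 κ₁-sends κ₂-sends B⁻-sends B-sends x =
      Sends-cong ≋-refl ≋ᵥ-refl (scalars (ofℕ-nonzero x)) ≋ᵥ-refl
        (Sends-scale (N ⁻¹ * (N ⁻¹ * N ⁻¹))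
           (Sends-⊗ (Sends-⊗ (Sends-⊗ κ₂-sends B⁻-sends) κ₁-sends) B-sends)) x
      where
      scalars : ¬ N ≈ 0# → N ⁻¹ * (N ⁻¹ * N ⁻¹) * (N * h₂ * a ⁻¹ * (N * h₁) * (N * a)) ≈ h₁ * h₂
      scalars N≉0 = begin
        N ⁻¹ * (N ⁻¹ * N ⁻¹) * (N * h₂ * a ⁻¹ * (N * h₁) * (N * a))
          ≈⟨ solve 6 (λ m′ m p q r r′ → m′ :* (m′ :* m′) :* (m :* q :* r′ :* (m :* p) :* (m :* r))
                                       := m′ :* m :* (m′ :* m :* (m′ :* m :* (r :* r′))) :* (p :* q))
                     refl (N ⁻¹) N h₁ h₂ a (a ⁻¹) ⟩
        N ⁻¹ * N * (N ⁻¹ * N * (N ⁻¹ * N * (a * a ⁻¹))) * (h₁ * h₂)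
          ≈⟨ *-congʳ (*-cong one (*-cong one (*-cong one (inverseʳ a a≉0)))) ⟩
        1# * (1# * (1# * 1#)) * (h₁ * h₂)
          ≈⟨ *-congʳ (trans (*-identityˡ _) (trans (*-identityˡ _) (*-identityˡ _))) ⟩
        1# * (h₁ * h₂)
          ≈⟨ *-identityˡ (h₁ * h₂) ⟩
        h₁ * h₂ ∎
        where
        one : N ⁻¹ * N ≈ 1#
        one = ⁻¹-inverseˡ N≉0

    F₀-Θᴬ : ∀ {H₁ H₂ η₁ η₂ κ₁ κ₂ : Mat K n} → IsΘ K A B H₁ η₁ → η₁ ≋ κ₁ ᵀ →
            IsΘ K A B H₂ η₂ → η₂ ≋ κ₂ ᵀ → IsΘ₁ K A (F₀ κ₁ κ₂) (H₁ ∘ₛ H₂)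
    F₀-Θᴬ eigen₁ η₁≋κ₁ᵀ eigen₂ η₂≋κ₂ᵀ i j =
      Sends-cong ≋-refl rows≋columns refl rows≋columns
        (F₀-sends (A≉0 i j) (κ-sends eigen₁ η₁≋κ₁ᵀ) (κ-sends eigen₂ η₂≋κ₂ᵀ)
                  (B⁻-sends-B-rows i j) (B-sends-B-rows i j))
      where
      κ-sends : ∀ {H η κ : Mat K n} → IsΘ K A B H η → η ≋ κ ᵀ →
                Sends κ (A i ∘ᵥ A⁻ j) (N * H i j) (B j ∘ᵥ B⁻ i)
      κ-sends eigen η≋κᵀ =
        Sends-cong (λ x y → η≋κᵀ y x) ≋ᵥ-refl refl ≋ᵥ-refl (IsΘ-sendsᵀ A-orthogonal B-inverse eigen i j)
      rows≋columns : A i ∘ᵥ A⁻ j ≋ᵥ col K A i ∘ᵥ col K A⁻ j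
      rows≋columns y = *-cong (symA i y) (⁻¹-cong (A≉0 j y) (symA j y))

    F₀-Θᴮ : ∀ {K₁ K₂ κ₁ κ₂ : Mat K n} → IsΘ K A (B ᵀ) (K₁ ᵀ) κ₁ → IsΘ K A (B ᵀ) (K₂ ᵀ) κ₂ →
            IsΘ₁ K B⁻ (F₀ κ₁ κ₂) (K₁ ∘ₛ K₂)
    F₀-Θᴮ eigen₁ eigen₂ i j =
      Sends-cong ≋-refl columns refl columns
        (F₀-sends (A≉0 i j) (κ-sends eigen₁) (κ-sends eigen₂) (B⁻-sends-A-rows i j) (B-sends-A-rows i j))
      where
      κ-sends : ∀ {K′ κ : Mat K n} → IsΘ K A (B ᵀ) (K′ ᵀ) κ →
                Sends κ (col K B j ∘ᵥ col K B⁻ i) (N * K′ i j) (A i ∘ᵥ A⁻ j)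
      κ-sends eigen = IsΘ-sendsᵀ Bᵀ-orthogonal A-inverse (IsΘ-swap eigen) j i
      columns : col K B j ∘ᵥ col K B⁻ i ≋ᵥ col K B⁻ i ∘ᵥ col K (schurInv K B⁻) j
      columns y = trans (*-comm (B y j) (B⁻ y i)) (*-congˡ (sym (⁻¹-involutive (B≉0 y j))))

    Θᴬ-dual : ∀ {F φ : Mat K n} → IsΘ₁ K A F φ → IsΘ K A A⁻ φ (λ i l → N * F l i)
    Θᴬ-dual eigen =
      IsΘ-cong (λ i j → sym (symA i j)) (λ i j → ⁻¹-cong (A≉0 j i) (symA j i)) ≋-refl ≋-refl
        (IsΘ-swap (IsΘ-dual (RowOrthogonal-sym A-orthogonal) A-inverse (IsΘ-swap eigen)))

    Θᴮ-dual : ∀ {F ψ : Mat K n} → IsΘ₁ K B⁻ F ψ → IsΘ K (B ᵀ) (B⁻ ᵀ) (ψ ᵀ) (λ i l → N * F l i)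
    Θᴮ-dual eigen =
      IsΘ-swap (IsΘ-dual (RowOrthogonal-sym B-orthogonal) B-inverse
                         (IsΘ-cong ≋-refl (λ i j → ⁻¹-involutive (B≉0 i j)) ≋-refl ≋-refl eigen))

    schurᴴ : ∀ {F φ H η : Mat K n} → IsΘ₁ K A F φ → IsΘ K A B H η → IsΘ K A B (φ ∘ₛ H) (F ᵀ ⊗ η)
    schurᴴ eigenF eigenH = IsΘ-schur A-orthogonal A-inverse (Θᴬ-dual eigenF) eigenH

    schurᴷ : ∀ {F ψ K′ κ : Mat K n} → IsΘ₁ K B⁻ F ψ → IsΘ K A (B ᵀ) (K′ ᵀ) κ →
             IsΘ K A (B ᵀ) ((ψ ∘ₛ K′) ᵀ) (κ ⊗ F)
    schurᴷ {F} {κ = κ} eigenF eigenK =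
      IsΘ-cong ≋-refl ≋-refl ≋-refl (⊗-ᵀ (F ᵀ) (κ ᵀ))
        (IsΘ-swap (IsΘ-schur Bᵀ-orthogonal Bᵀ-inverse (Θᴮ-dual eigenF) (IsΘ-swap eigenK)))

    In𝓑-∘ₛ-closed : ∀ X Y → In𝓑 K A B X → In𝓑 K A B Y → In𝓑 K A B (X ∘ₛ Y)
    In𝓑-∘ₛ-closed X Y
      (F₁ , G₁ , H₁ , K₁ , a₁ , b₁ , g₁ , t₁ , h₁ , k₁ , eF₁ , eF₁′ , eG₁ , eGᵀ₁ , eH₁ , eKᵀ₁ , h₁≋k₁ᵀ , X≋)
      (F₂ , G₂ , H₂ , K₂ , a₂ , b₂ , g₂ , t₂ , h₂ , k₂ , eF₂ , eF₂′ , eG₂ , eGᵀ₂ , eH₂ , eKᵀ₂ , h₂≋k₂ᵀ , Y≋) =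
        F₁ ⊗ F₂ ⊕ F₀ k₁ k₂ , G₁ ⊗ G₂ , a₁ ∘ₛ H₂ ⊕ a₂ ∘ₛ H₁ , b₁ ∘ₛ K₂ ⊕ b₂ ∘ₛ K₁ ,
        a₁ ∘ₛ a₂ ⊕ H₁ ∘ₛ H₂ , b₁ ∘ₛ b₂ ⊕ K₁ ∘ₛ K₂ , g₁ ∘ₛ g₂ , t₁ ∘ₛ t₂ ,
        F₁ ᵀ ⊗ h₂ ⊕ F₂ ᵀ ⊗ h₁ , k₂ ⊗ F₁ ⊕ k₁ ⊗ F₂ ,
        IsΘ-⊕ (IsΘ-⊗ eF₁ eF₂) (F₀-Θᴬ eH₁ h₁≋k₁ᵀ eH₂ h₂≋k₂ᵀ) ,
        IsΘ-⊕ (IsΘ-⊗ eF₁′ eF₂′) (F₀-Θᴮ eKᵀ₁ eKᵀ₂) ,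
        IsΘ-⊗ eG₁ eG₂ ,
        IsΘ-⊗ᵀ eGᵀ₁ eGᵀ₂ ,
        IsΘ-⊕ (schurᴴ eF₁ eH₂) (schurᴴ eF₂ eH₁) ,
        IsΘ-⊕ (schurᴷ eF₁′ eKᵀ₂) (schurᴷ eF₂′ eKᵀ₁) ,
        (λ i j → +-cong (ᵀ⊗-pairing F₁ h₂≋k₂ᵀ i j) (ᵀ⊗-pairing F₂ h₁≋k₁ᵀ i j)) ,
        (λ p q → trans (*-cong (X≋ p q) (Y≋ p q)) (𝓜-∘ₛ p q))

open Defs

lemma6p6 : ∀ {c ℓ} (K : ACField c ℓ) (n : ℕ) (A B : Mat K n) →
           InvertibleJonesPair K A B → Symmetric K A →
           ∀ X Y → In𝓑 K A B X → In𝓑 K A B Y → In𝓑 K A B (_∘ₛ_ K X Y)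
lemma6p6 K n A B pair symA = JonesPairs.SymmetricInvertibleJonesPair.In𝓑-∘ₛ-closed K pair symA
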